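{- Let $D$ be a strongly connected balanced bipartite digraph with partite sets of cardinalities $a$, where $a\geq 2$. Suppose that $d(x)+d(y)\geq 3a$ for every pair of distinct vertices $x,y$ of $D$ which have a common in-neighbour or a common out-neighbour, and suppose that $D$ is not hamiltonian. Then for every vertex $u\in V(D)$ there exists a vertex $v\in V(D)\setminus\{u\}$ such that $u$ and $v$ have a common in-neighbour or a common out-neighbour in $D$.
   Context: Digraphs are finite, with no loops and no multiple arcs. $d(v)=d^+(v)+d^-(v)$ is the total degree. A digraph is hamiltonian if it has a directed cycle through all vertices. -}

module Defs where

open import Data.Nat using (ℕ; zero; suc; _+_)
open import Data.Bool using (Bool; true; false; T; not)
open import Data.Fin using (Fin; zero; suc)
open import Data.List using (List; []; _∷_; _++_; [_])
open import Data.List.Membership.Propositional using (_∈_)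
open import Data.List.Relation.Unary.Unique.Propositional using (Unique)
open import Data.Product using (Σ; ∃; _×_; _,_)
open import Data.Unit using (⊤)
open import Relation.Binary.PropositionalEquality using (_≡_; _≢_)
open import Relation.Binary.Construct.Closure.ReflexiveTransitive using (Star)

count : ∀ {n} → (Fin n → Bool) → ℕ
count {zero}  p = 0
count {suc n} p with p zero
... | true  = suc (count (λ i → p (suc i)))
... | false = count (λ i → p (suc i))

-- A digraph on vertex set Fin n: an adjacency predicate with no loops.
-- (No multiple arcs is automatic: there is at most one arc u → v.)
record Digraph (n : ℕ) : Set where
  field
    adj     : Fin n → Fin n → Bool
    loopless : ∀ v → adj v v ≡ false
open Digraph public

Arc : ∀ {n} → Digraph n → Fin n → Fin n → Set
Arc D u v = T (adj D u v)

outdeg : ∀ {n} → Digraph n → Fin n → ℕ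
outdeg D v = count (λ w → adj D v w)

indeg : ∀ {n} → Digraph n → Fin n → ℕ
indeg D v = count (λ w → adj D w v)

deg : ∀ {n} → Digraph n → Fin n → ℕ
deg D v = outdeg D v + indeg D v

StronglyConnected : ∀ {n} → Digraph n → Set
StronglyConnected D = ∀ u v → Star (Arc D) u v

ConsecArcs : ∀ {n} → Digraph n → List (Fin n) → Set
ConsecArcs D []          = ⊤
ConsecArcs D (x ∷ [])    = ⊤
ConsecArcs D (x ∷ y ∷ r) = Arc D x y × ConsecArcs D (y ∷ r)

Hamiltonian : ∀ {n} → Digraph n → Set
Hamiltonian {n} D =
  Σ (Fin n) λ v → Σ (List (Fin n)) λ vs →
    Unique (v ∷ vs) × (∀ w → w ∈ (v ∷ vs)) × ConsecArcs D ((v ∷ vs) ++ [ v ])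

BalancedBipartite : ∀ {n} → Digraph n → ℕ → Set
BalancedBipartite {n} D a =
  Σ (Fin n → Bool) λ part →
    count part ≡ a × count (λ v → not (part v)) ≡ a ×
    (∀ u v → Arc D u v → part u ≢ part v)

CommonInNeighbour : ∀ {n} → Digraph n → Fin n → Fin n → Set
CommonInNeighbour D x y = ∃ λ z → Arc D z x × Arc D z y

CommonOutNeighbour : ∀ {n} → Digraph n → Fin n → Fin n → Set
CommonOutNeighbour D x y = ∃ λ z → Arc D x z × Arc D y z

-- Call a vertex solitary if it shares no in-neighbour and no out-neighbour with
-- any other vertex. If u is solitary, every r ≠ u misses an arc to the opposite
-- partite set, so d(r) ≤ 2a - 1. If moreover t is solitary and t → s with s ≠ u,
-- then t is the only in-neighbour of s and s misses an out-arc, so d(s) ≤ a; the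
-- degree condition (d(s) + d(v) ≤ 3a - 1 < 3a) then forbids s from having any
-- sibling v. By strong connectivity every vertex is solitary, so D is a
-- strongly connected digraph whose arcs form a permutation, i.e. a hamiltonian
-- cycle.
module Submission where

open import Defs
open import Data.Nat using (ℕ; zero; suc; _≤_; _<_; _+_; _*_; z≤n; s≤s)
open import Data.Nat.Properties
  using (≤-pred; ≤-refl; ≤-reflexive; ≤-trans; n≤1+n; <⇒≱; m≤n⇒m≤1+n; m<n⇒m<1+n; m≤n⇒m<n∨m≡n;
         +-comm; +-identityʳ; +-monoʳ-≤; +-mono-≤-<; +-mono-<-≤)
open import Data.Nat.GeneralisedArithmetic using (iterate)
open import Data.Fin using (Fin; zero; suc)
open import Data.Fin.Properties using (any?; _≟_; 0≢1+n; suc-injective)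
open import Data.Bool using (Bool; true; false; T; not)
open import Data.Bool.Properties using (¬-not)
import Data.Bool.Properties as Bool
open import Data.Unit using (tt)
open import Data.Empty using (⊥-elim)
open import Data.Product using (Σ; ∃; _×_; _,_; proj₁; proj₂)
open import Data.Sum using (_⊎_; inj₁; inj₂)
import Data.List as List
open import Data.List using (List; []; _∷_; _++_; [_])
open import Data.List.Relation.Unary.All using (tabulate)
open import Data.List.Relation.Unary.Any using (here; there)
open import Data.List.Relation.Unary.AllPairs using ([]; _∷_)
open import Data.List.Membership.Propositional using (_∈_)
open import Data.List.Relation.Unary.Unique.Propositional using (Unique)
open import Function using (_∘_; id)
open import Relation.Nullary using (¬_; Dec; yes; no; contradiction)
open import Relation.Nullary.Decidable using (T?; ¬?; _×-dec_; _⊎-dec_)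
open import Relation.Unary using (Decidable)
open import Relation.Binary.PropositionalEquality
  using (_≡_; _≢_; refl; sym; trans; cong; subst; ≢-sym)
open import Relation.Binary.Construct.Closure.ReflexiveTransitive
  using (Star; ε; _◅_; fold)

count-mono : ∀ {n} {p q : Fin n → Bool} →
             (∀ i → T (p i) → T (q i)) → count p ≤ count q
count-mono {zero}          p⊆q = z≤n
count-mono {suc n} {p} {q} p⊆q with p zero | q zero | p⊆q zero
... | true  | true  | _      = s≤s (count-mono (p⊆q ∘ suc))
... | true  | false | p₀⇒q₀ = ⊥-elim (p₀⇒q₀ tt)
... | false | true  | _      = m≤n⇒m≤1+n (count-mono (p⊆q ∘ suc))
... | false | false | _      = count-mono (p⊆q ∘ suc)

count-< : ∀ {n} {p q : Fin n → Bool} → (∀ i → T (p i) → T (q i)) →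
          ∀ m → T (q m) → ¬ T (p m) → count p < count q
count-< {suc n} {p} {q} p⊆q zero qₘ ¬pₘ with p zero | q zero
... | true  | _     = ⊥-elim (¬pₘ tt)
... | false | true  = s≤s (count-mono (p⊆q ∘ suc))
... | false | false = ⊥-elim qₘ
count-< {suc n} {p} {q} p⊆q (suc m) qₘ ¬pₘ with p zero | q zero | p⊆q zero
... | true  | true  | _      = s≤s (count-< (p⊆q ∘ suc) m qₘ ¬pₘ)
... | true  | false | p₀⇒q₀ = ⊥-elim (p₀⇒q₀ tt)
... | false | true  | _      = m<n⇒m<1+n (count-< (p⊆q ∘ suc) m qₘ ¬pₘ)
... | false | false | _      = count-< (p⊆q ∘ suc) m qₘ ¬pₘ

count-≡0 : ∀ {n} {p : Fin n → Bool} → (∀ i → ¬ T (p i)) → count p ≡ 0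
count-≡0 {zero}      none = refl
count-≡0 {suc n} {p} none with p zero | none zero
... | true  | ¬p₀ = ⊥-elim (¬p₀ tt)
... | false | _   = count-≡0 (none ∘ suc)

count-≤-1+tail : ∀ {n} (p : Fin (suc n) → Bool) → count p ≤ suc (count (p ∘ suc))
count-≤-1+tail p with p zero
... | true  = ≤-refl
... | false = n≤1+n _

count-≤1 : ∀ {n} {p : Fin n → Bool} t → (∀ i → T (p i) → i ≡ t) → count p ≤ 1
count-≤1 {suc n} {p} zero only =
  ≤-trans (count-≤-1+tail p) (s≤s (≤-reflexive (count-≡0 λ i pᵢ → 0≢1+n (sym (only (suc i) pᵢ)))))
count-≤1 {suc n} {p} (suc t) only with p zero | only zero
... | true  | p₀⇒0≡1+t = contradiction (p₀⇒0≡1+t tt) 0≢1+n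
... | false | _        = count-≤1 t (λ i pᵢ → suc-injective (only (suc i) pᵢ))

count≥2⇒other : ∀ {n} {p : Fin n → Bool} → 2 ≤ count p →
                ∀ x → ∃ λ y → y ≢ x × T (p y)
count≥2⇒other {p = p} count≥2 x with any? (λ y → ¬? (y ≟ x) ×-dec T? (p y))
... | yes other = other
... | no ¬other = contradiction (count-≤1 x only-x) (<⇒≱ count≥2)
  where
  only-x : ∀ i → T (p i) → i ≡ x
  only-x i pᵢ with i ≟ x
  ... | yes i≡x = i≡x
  ... | no  i≢x = contradiction (i , i≢x , pᵢ) ¬other

minimal-witness : ∀ {p} {P : ℕ → Set p} → Decidable P → ∀ N → P N →
                  ∃ λ k → P k × (∀ {d} → d < k → ¬ P d)
minimal-witness P? zero    p₀ = 0 , p₀ , λ ()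
minimal-witness P? (suc N) pN with P? 0
... | yes p₀  = 0 , p₀ , λ ()
... | no  ¬p₀ with minimal-witness (P? ∘ suc) N pN
...   | k , pₖ , below = suc k , pₖ , λ { {zero} _ → ¬p₀ ; {suc d} d<k → below (≤-pred d<k) }

Siblings : ∀ {n} → Digraph n → Fin n → Fin n → Set
Siblings D x y = CommonInNeighbour D x y ⊎ CommonOutNeighbour D x y

Solitary : ∀ {n} → Digraph n → Fin n → Set
Solitary D x = ∀ y → y ≢ x → ¬ Siblings D x y

module _ {n} (D : Digraph n) where

  siblings-sym : ∀ {x y} → Siblings D x y → Siblings D y x
  siblings-sym (inj₁ (z , z→x , z→y)) = inj₁ (z , z→y , z→x)
  siblings-sym (inj₂ (z , x→z , y→z)) = inj₂ (z , y→z , x→z)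

  siblings? : ∀ x y → Dec (Siblings D x y)
  siblings? x y = any? (λ z → T? (adj D z x) ×-dec T? (adj D z y))
           ⊎-dec any? (λ z → T? (adj D x z) ×-dec T? (adj D y z))

  solitary⇒sole-out-neighbour : ∀ {t w w′} → Solitary D w →
                                Arc D t w → Arc D t w′ → w′ ≡ w
  solitary⇒sole-out-neighbour {t} {w} {w′} solitary t→w t→w′ with w′ ≟ w
  ... | yes w′≡w = w′≡w
  ... | no  w′≢w = contradiction (inj₁ (t , t→w , t→w′)) (solitary w′ w′≢w)

  solitary⇒sole-in-neighbour : ∀ {s b b′} → Solitary D b →
                               Arc D b s → Arc D b′ s → b′ ≡ b
  solitary⇒sole-in-neighbour {s} {b} {b′} solitary b→s b′→s with b′ ≟ b
  ... | yes b′≡b = b′≡b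
  ... | no  b′≢b = contradiction (inj₂ (s , b→s , b′→s)) (solitary b′ b′≢b)

  strongly-connected⇒out-arc : StronglyConnected D → ∀ {y z} → z ≢ y → ∃ (Arc D y)
  strongly-connected⇒out-arc strong {y} {z} z≢y with strong y z
  ... | ε         = contradiction refl z≢y
  ... | y→w ◅ _   = _ , y→w

module PermutationDigraph {n} (D : Digraph n) (strong : StronglyConnected D)
  (next : Fin n → Fin n) (arc-next : ∀ y → Arc D y (next y))
  (out-unique : ∀ {y w} → Arc D y w → w ≡ next y)
  (next-injective : ∀ {y z} → next y ≡ next z → y ≡ z) where

  next^ : ℕ → Fin n → Fin n
  next^ j y = iterate next y j

  next^-suc : ∀ j y → next^ (suc j) y ≡ next (next^ j y)
  next^-suc zero    y = refl
  next^-suc (suc j) y = next^-suc j (next y)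

  reachable⇒next^ : ∀ {y w} → Star (Arc D) y w → ∃ λ j → next^ j y ≡ w
  reachable⇒next^ ε = 0 , refl
  reachable⇒next^ (y→z ◅ z↝w) with reachable⇒next^ z↝w
  ... | j , next^j≡w = suc j , trans (cong (next^ j) (sym (out-unique y→z))) next^j≡w

  trail : Fin n → ℕ → List (Fin n)
  trail = List.iterate next

  ∈-trail : ∀ y {m j} → j < m → next^ j y ∈ trail y m
  ∈-trail y {suc m} {zero}  _           = here refl
  ∈-trail y {suc m} {suc j} (s≤s j<m)   = there (∈-trail (next y) j<m)

  ∈-trail⁻ : ∀ y m {w} → w ∈ trail y m → ∃ λ j → j < m × w ≡ next^ j y
  ∈-trail⁻ y (suc m) (here w≡y)  = 0 , s≤s z≤n , w≡y
  ∈-trail⁻ y (suc m) (there w∈)  with ∈-trail⁻ (next y) m w∈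
  ... | j , j<m , w≡ = suc j , s≤s j<m , w≡

  trail-arcs : ∀ y m → ConsecArcs D (trail y m ++ [ next^ m y ])
  trail-arcs y zero          = tt
  trail-arcs y (suc zero)    = arc-next y , tt
  trail-arcs y (suc (suc m)) = arc-next y , trail-arcs (next y) (suc m)

  trail-unique : ∀ y m → (∀ {d} → suc d < m → next^ (suc d) y ≢ y) → Unique (trail y m)
  trail-unique y zero    _         = []
  trail-unique y (suc m) no-return =
    tabulate y∉ ∷ trail-unique (next y) m no-return′
    where
    y∉ : ∀ {w} → w ∈ trail (next y) m → y ≢ w
    y∉ w∈ with ∈-trail⁻ (next y) m w∈
    ... | j , j<m , refl = ≢-sym (no-return (s≤s j<m))
    no-return′ : ∀ {d} → suc d < m → next^ (suc d) (next y) ≢ next y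
    no-return′ {d} sd<m returns =
      no-return (m<n⇒m<1+n sd<m) (next-injective (trans (sym (next^-suc (suc d) y)) returns))

  module Cycle (u : Fin n) where

    first-return : ∃ λ k → next^ (suc k) u ≡ u × (∀ {d} → d < k → next^ (suc d) u ≢ u)
    first-return = let j , next^j≡u = reachable⇒next^ (strong (next u) u)
                   in minimal-witness (λ d → next^ (suc d) u ≟ u) j next^j≡u

    k : ℕ
    k = proj₁ first-return

    returns : next^ (suc k) u ≡ u
    returns = proj₁ (proj₂ first-return)

    no-earlier-return : ∀ {d} → d < k → next^ (suc d) u ≢ u
    no-earlier-return = proj₂ (proj₂ first-return)

    cycle : List (Fin n)
    cycle = trail u (suc k)

    next-∈-cycle : ∀ {w} → w ∈ cycle → next w ∈ cycle
    next-∈-cycle w∈ with ∈-trail⁻ u (suc k) w∈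
    ... | i , s≤s i≤k , refl with m≤n⇒m<n∨m≡n i≤k
    ...   | inj₁ i<k  = subst (_∈ cycle) (next^-suc i u) (∈-trail u (s≤s i<k))
    ...   | inj₂ refl = subst (_∈ cycle) (trans (sym returns) (next^-suc k u)) (here refl)

    next^-∈-cycle : ∀ j → next^ j u ∈ cycle
    next^-∈-cycle zero    = here refl
    next^-∈-cycle (suc j) = subst (_∈ cycle) (sym (next^-suc j u)) (next-∈-cycle (next^-∈-cycle j))

    hamiltonian : Hamiltonian D
    hamiltonian =
      u , trail (next u) k ,
      trail-unique u (suc k) (no-earlier-return ∘ ≤-pred) ,
      (λ w → let j , next^j≡w = reachable⇒next^ (strong u w)
             in subst (_∈ cycle) next^j≡w (next^-∈-cycle j)) ,
      subst (λ x → ConsecArcs D (cycle ++ [ x ])) returns (trail-arcs u (suc k))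

all-solitary⇒hamiltonian : ∀ {n} {D : Digraph n} → StronglyConnected D →
                           (∀ v → Solitary D v) → ∀ {u u′} → u′ ≢ u → Hamiltonian D
all-solitary⇒hamiltonian {n} {D} strong solitary {u} {u′} u′≢u =
  PermutationDigraph.Cycle.hamiltonian D strong next arc-next out-unique next-injective u
  where
  other : ∀ y → ∃ λ z → z ≢ y
  other y with y ≟ u
  ... | yes refl = u′ , u′≢u
  ... | no  y≢u  = u , ≢-sym y≢u

  next : Fin n → Fin n
  next y = proj₁ (strongly-connected⇒out-arc D strong (proj₂ (other y)))

  arc-next : ∀ y → Arc D y (next y)
  arc-next y = proj₂ (strongly-connected⇒out-arc D strong (proj₂ (other y)))

  out-unique : ∀ {y w} → Arc D y w → w ≡ next y
  out-unique {y} = solitary⇒sole-out-neighbour D (solitary (next y)) (arc-next y)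

  next-injective : ∀ {y z} → next y ≡ next z → y ≡ z
  next-injective {y} {z} next-y≡next-z =
    solitary⇒sole-in-neighbour D (solitary z) (arc-next z) (subst (Arc D y) next-y≡next-z (arc-next y))

module BalancedBipartiteDegrees {n} (D : Digraph n) {a} (a≥2 : 2 ≤ a)
  (part : Fin n → Bool)
  (count-part : count part ≡ a) (count-not-part : count (λ v → not (part v)) ≡ a)
  (bipartite : ∀ u v → Arc D u v → part u ≢ part v) where

  colour-class : Bool → Fin n → Bool
  colour-class true  = part
  colour-class false = λ v → not (part v)

  count-colour-class : ∀ b → count (colour-class b) ≡ a
  count-colour-class true  = count-part
  count-colour-class false = count-not-part

  ∈-colour-class : ∀ {b m} → part m ≡ b → T (colour-class b m)
  ∈-colour-class {true}  {m} part-m≡b rewrite part-m≡b = tt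
  ∈-colour-class {false} {m} part-m≡b rewrite part-m≡b = tt

  ∈-colour-class⁻ : ∀ {b m} → T (colour-class b m) → part m ≡ b
  ∈-colour-class⁻ {true}  {m} m∈ with part m
  ... | true  = refl
  ∈-colour-class⁻ {false} {m} m∈ with part m
  ... | false = refl

  ∈-opposite-class : ∀ {r m} → part m ≢ part r → T (colour-class (not (part r)) m)
  ∈-opposite-class = ∈-colour-class ∘ ¬-not

  indeg-≤ : ∀ r → indeg D r ≤ a
  indeg-≤ r = subst (indeg D r ≤_) (count-colour-class (not (part r)))
                    (count-mono (λ m m→r → ∈-opposite-class (bipartite m r m→r)))

  outdeg-< : ∀ {r} m → part m ≢ part r → ¬ Arc D r m → outdeg D r < a
  outdeg-< {r} m opposite ¬r→m =
    subst (outdeg D r <_) (count-colour-class (not (part r)))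
          (count-< (λ m′ r→m′ → ∈-opposite-class (≢-sym (bipartite r m′ r→m′)))
                   m (∈-opposite-class opposite) ¬r→m)

  same-class-other : ∀ x → ∃ λ y → y ≢ x × part y ≡ part x
  same-class-other x with count≥2⇒other (subst (2 ≤_) (sym (count-colour-class (part x))) a≥2) x
  ... | y , y≢x , y∈ = y , y≢x , ∈-colour-class⁻ y∈

  -- If s → t, then s misses the other vertices of t's class, which share the
  -- in-neighbour s with t.
  outdeg-<-towards-solitary : ∀ {s t} → Solitary D t → part s ≢ part t → outdeg D s < a
  outdeg-<-towards-solitary {s} {t} t-solitary opposite with T? (adj D s t)
  ... | no  ¬s→t = outdeg-< t (≢-sym opposite) ¬s→t
  ... | yes s→t with same-class-other t
  ...   | t′ , t′≢t , same = outdeg-< t′ (λ e → opposite (sym (trans (sym same) e)))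
                                      (λ s→t′ → t-solitary t′ t′≢t (inj₁ (s , s→t , s→t′)))

  module SolitaryVertex (strong : StronglyConnected D)
    (ore : ∀ x y → x ≢ y → Siblings D x y → 3 * a ≤ deg D x + deg D y)
    (u : Fin n) (u-solitary : Solitary D u) where

    u-out : ∃ (Arc D u)
    u-out = strongly-connected⇒out-arc D strong (proj₁ (proj₂ (same-class-other u)))

    ≢u⇒outdeg-< : ∀ {r} → r ≢ u → outdeg D r < a
    ≢u⇒outdeg-< {r} r≢u with part r Bool.≟ part u | u-out
    ... | no  opposite | _       = outdeg-<-towards-solitary u-solitary opposite
    ... | yes same     | w , u→w =
      outdeg-< w (λ e → bipartite u w u→w (trans (sym same) (sym e)))
                 (λ r→w → u-solitary r r≢u (inj₂ (w , u→w , r→w)))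

    ≢u⇒deg-< : ∀ {r} → r ≢ u → deg D r < a + a
    ≢u⇒deg-< {r} r≢u = +-mono-<-≤ (≢u⇒outdeg-< r≢u) (indeg-≤ r)

    solitary-step : ∀ {t s} → Solitary D t → Arc D t s → Solitary D s
    solitary-step {t} {s} t-solitary t→s with s ≟ u
    ... | yes refl = u-solitary
    ... | no  s≢u  = no-sibling
      where
      indeg-s≤1 : indeg D s ≤ 1
      indeg-s≤1 = count-≤1 t (λ y y→s → solitary⇒sole-in-neighbour D t-solitary t→s y→s)

      deg-s≤a : deg D s ≤ a
      deg-s≤a = ≤-trans (+-monoʳ-≤ (outdeg D s) indeg-s≤1)
                        (subst (_≤ a) (+-comm 1 (outdeg D s))
                               (outdeg-<-towards-solitary t-solitary (≢-sym (bipartite t s t→s))))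

      no-sibling : Solitary D s
      no-sibling v v≢s siblings with v ≟ u
      ... | yes refl = u-solitary s s≢u (siblings-sym D siblings)
      ... | no  v≢u  = <⇒≱ (+-mono-≤-< deg-s≤a (≢u⇒deg-< v≢u))
                           (subst (_≤ deg D s + deg D v) (cong (λ x → a + (a + x)) (+-identityʳ a))
                                  (ore s v (≢-sym v≢s) siblings))

    all-solitary : ∀ t → Solitary D t
    all-solitary t = fold (λ x y → Solitary D x → Solitary D y)
                          (λ t→s s↝ t-solitary → s↝ (solitary-step t-solitary t→s)) id
                          (strong u t) u-solitary

lemma3p2 : ∀ {n} (D : Digraph n) (a : ℕ) →
    2 ≤ a →
    BalancedBipartite D a →
    StronglyConnected D →
    (∀ x y → x ≢ y → CommonInNeighbour D x y ⊎ CommonOutNeighbour D x y →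
      3 * a ≤ deg D x + deg D y) →
    ¬ Hamiltonian D →
    ∀ u → Σ (Fin n) λ v → v ≢ u × (CommonInNeighbour D u v ⊎ CommonOutNeighbour D u v)
lemma3p2 D a a≥2 (part , count-part , count-not-part , bipartite) strong ore ¬hamiltonian u
  with any? (λ v → ¬? (v ≟ u) ×-dec siblings? D u v)
... | yes sibling   = sibling
... | no  ¬sibling  =
  contradiction (all-solitary⇒hamiltonian strong (SolitaryVertex.all-solitary strong ore u u-solitary)
                                          (proj₁ (proj₂ (same-class-other u))))
                ¬hamiltonian
  where
  open BalancedBipartiteDegrees D a≥2 part count-part count-not-part bipartite
  u-solitary : Solitary D u
  u-solitary v v≢u siblings = ¬sibling (v , v≢u , siblings)
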